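{- Let $p$ be a prime, $l,k,i,j$ integers with $0\le j\le l$, $0\le i\le k$, $A=\mathrm{diag}[p^l,p^{l+k}]$, $\mathbf a=(p^j,p^{i+j})^T$, and let $S_{\mathbf a}$ be the stabilizer of $\mathbf a\bmod A\mathbb Z^2$ in $G_{l,k}$. Put $n=\min(i,k-i,l-j)$. Then $\det_{l,k}(S_{\mathbf a})=U_n/U_l$.
   Context: $\Gamma_0(p^k)$ is the subgroup of $GL_2(\mathbb Z_p)$ of matrices whose $(2,1)$ entry is divisible by $p^k$; it acts on $\mathbb Z^2/A\mathbb Z^2\cong\mathbb Z_p^2/A\mathbb Z_p^2$ by matrix multiplication. $\Gamma(p^l,p^{l+k})=\{I+\mathrm{diag}[p^l,p^{l+k}]M: M\in M_2(\mathbb Z_p)\}\cap GL_2(\mathbb Z_p)$ is exactly the subgroup of $\Gamma_0(p^k)$ acting trivially on $\mathbb Z^2/A\mathbb Z^2$; $G_{l,k}=\Gamma_0(p^k)/\Gamma(p^l,p^{l+k})$, which acts on $\mathbb Z^2/A\mathbb Z^2$. $U_0=\mathbb Z_p^\times$, $U_m=1+p^m\mathbb Z_p$ for $m>0$, and $\det_{l,k}:G_{l,k}\to U_0/U_l$ is induced by the determinant. -}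

module Defs where

open import Data.Nat using (ℕ; _⊔_; _⊓_; _∸_)
open import Data.Integer using (ℤ; +_; _+_; _-_; _*_; _^_)
open import Data.Integer.Divisibility using (_∣_)
open import Data.Product using (_×_; Σ; ∃)
open import Relation.Nullary using (¬_)

record M2 : Set where
  constructor mat
  field
    e11 e12 e21 e22 : ℤ
open M2 public

det : M2 → ℤ
det g = e11 g * e22 g - e12 g * e21 g

infix 4 _≡_[mod_]
_≡_[mod_] : ℤ → ℤ → ℤ → Set
x ≡ y [mod m ] = m ∣ (x - y)

-- g represents an element of Γ₀(p^k): det g is a p-adic unit and p^k ∣ (2,1)-entry
InΓ₀ : ℕ → ℕ → M2 → Set
InΓ₀ p k g = (¬ ((+ p) ∣ det g)) × ((+ p) ^ k ∣ e21 g)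

Fixes : ℕ → ℕ → ℕ → ℕ → ℕ → M2 → Set
Fixes p l k i j g =
  (e11 g * (+ p) ^ j + e12 g * (+ p) ^ (i Data.Nat.+ j) ≡ (+ p) ^ j [mod (+ p) ^ l ])
  × (e21 g * (+ p) ^ j + e22 g * (+ p) ^ (i Data.Nat.+ j) ≡ (+ p) ^ (i Data.Nat.+ j) [mod (+ p) ^ (l Data.Nat.+ k) ])

InStab : ℕ → ℕ → ℕ → ℕ → ℕ → M2 → Set
InStab p l k i j g = InΓ₀ p k g × Fixes p l k i j g

-- the class of the unit u in U₀/U_l lies in det_{l,k}(S_a)
InDetStab : ℕ → ℕ → ℕ → ℕ → ℕ → ℤ → Set
InDetStab p l k i j u = Σ M2 (λ g → InStab p l k i j g × (det g ≡ u [mod (+ p) ^ l ]))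

-- the class of the unit u in U₀/U_l lies in U_n/U_l  (for n = 0 the
-- divisibility condition is vacuous, matching U₀ = ℤ_p^×)
InU : ℕ → ℕ → ℤ → Set
InU p n u = u ≡ + 1 [mod (+ p) ^ n ]

nIndex : ℕ → ℕ → ℕ → ℕ → ℕ
nIndex l k i j = i ⊓ ((k ∸ i) ⊓ (l ∸ j))

{-# OPTIONS --safe #-}
-- Write g = [[a, b], [c, d]] with p^k ∣ c.  Fixing (p^j, p^{i+j}) modulo diag[p^l, p^{l+k}]
-- means p^{l-j} ∣ (a - 1) + b p^i and p^{l+k-i-j} ∣ c/p^i + (d - 1); as n ≤ i, k - i, l - j,
-- this gives a ≡ d ≡ 1 and c ≡ 0 modulo p^n, hence det g ≡ 1 (mod p^n).
-- Conversely [[1 + t p^i, -t], [0, 1]], [[1, 0], [-t p^k, 1 + t p^{k-i}]] and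
-- diag[1 + t p^{l-j}, 1] stabilise the vector, and their determinants 1 + t p^e cover
-- every unit ≡ 1 modulo p^e for each of the three exponents e whose minimum is n.
module Submission where

open import Defs
open import Data.Nat using (ℕ; _≤_)
open import Data.Nat.Primality using (Prime)
open import Data.Integer using (ℤ; +_)
open import Data.Integer.Divisibility using (_∣_)
open import Relation.Nullary using (¬_)
open import Function.Bundles using (_⇔_)

open import Data.Nat as Nat using (_∸_; _⊓_)
import Data.Nat.Properties as Nat
import Data.Nat.Tactic.RingSolver as Nat
open import Data.Nat.Primality using (prime⇒nonZero)
open import Data.Integer using (_+_; _-_; _*_; _^_; -_; 0ℤ; 1ℤ; NonZero)
open import Data.Integer.Properties using (^-distribˡ-+-*; i*j≢0; +-inverseʳ; *-zeroˡ)
open import Data.Integer.Divisibility.Signed as Signed using (divides)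
  renaming (_∣_ to _∣ₛ_)
open import Data.Integer.Tactic.RingSolver using (solve-∀)
open import Data.Product using (_,_)
open import Data.Sum using (inj₁; inj₂)
open import Data.Nat.Divisibility using (_∣0)
open import Function.Bundles using (mk⇔)
open import Relation.Binary.PropositionalEquality
  using (_≡_; refl; sym; trans; cong; cong₂; subst; module ≡-Reasoning)

^-nonZero : ∀ q .{{_ : NonZero q}} n → NonZero (q ^ n)
^-nonZero q Nat.zero    = _
^-nonZero q (Nat.suc n) = i*j≢0 q (q ^ n)
  where instance _ = ^-nonZero q n

^-split : ∀ q {m n} → m ≤ n → q ^ n ≡ q ^ (n ∸ m) * q ^ m
^-split q {m} {n} m≤n = begin
  q ^ n                 ≡⟨ cong (q ^_) (Nat.m∸n+n≡m m≤n) ⟨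
  q ^ (n ∸ m Nat.+ m)   ≡⟨ ^-distribˡ-+-* q (n ∸ m) m ⟩
  q ^ (n ∸ m) * q ^ m   ∎
  where open ≡-Reasoning

^-monoʳ-∣ : ∀ q {m n} → m ≤ n → q ^ m ∣ₛ q ^ n
^-monoʳ-∣ q {m} {n} m≤n = divides (q ^ (n ∸ m)) (^-split q m≤n)

^-cancelʳ-∣ : ∀ q .{{_ : NonZero q}} n j {e x} →
              n Nat.+ j ≤ e → q ^ e ∣ₛ x * q ^ j → q ^ n ∣ₛ x
^-cancelʳ-∣ q n j {e} {x} n+j≤e qᵉ∣x*qʲ =
  Signed.*-cancelʳ-∣ (q ^ j) {{^-nonZero q j}} (begin
  q ^ n * q ^ j   ≡⟨ ^-distribˡ-+-* q n j ⟨
  q ^ (n Nat.+ j) ∣⟨ ^-monoʳ-∣ q n+j≤e ⟩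
  q ^ e           ∣⟨ qᵉ∣x*qʲ ⟩
  x * q ^ j       ∎)
  where open Signed.∣-Reasoning

≡⇒≡-mod : ∀ {x y} m → x ≡ y → x ≡ y [mod m ]
≡⇒≡-mod {x} m refl =
  Signed.∣⇒∣ᵤ {m} (divides 0ℤ (trans (+-inverseʳ x) (sym (*-zeroˡ m))))

≡-mod-of-difference : ∀ {x y} m t → x - y ≡ t * m → x ≡ y [mod m ]
≡-mod-of-difference m t eq = Signed.∣⇒∣ᵤ {m} (divides t eq)

≡unitriangular⇒det≡1 : ∀ {m} g → m ∣ₛ e11 g - 1ℤ → m ∣ₛ e21 g → m ∣ₛ e22 g - 1ℤ →
                        m ∣ₛ det g - 1ℤ
≡unitriangular⇒det≡1 {m} (mat a b c d) m∣a-1 m∣c m∣d-1 =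
  subst (m ∣ₛ_) (sym (expand a b c d))
    (Signed.∣m∣n⇒∣m-n (Signed.∣m∣n⇒∣m+n (Signed.∣m⇒∣m*n d m∣a-1) m∣d-1)
                      (Signed.∣n⇒∣m*n b m∣c))
  where
  expand : ∀ a b c d → a * d - b * c - 1ℤ ≡ (a - 1ℤ) * d + (d - 1ℤ) - b * c
  expand = solve-∀

module _ (p : ℕ) (l k i j : ℕ) where
  private
    q : ℤ
    q = + p

  module _ .{{_ : Nat.NonZero p}} where

    fixes₁⇒≡1 : ∀ {n} a b → n ≤ i → n Nat.+ j ≤ l →
                a * q ^ j + b * q ^ (i Nat.+ j) ≡ q ^ j [mod q ^ l ] → q ^ n ∣ₛ a - 1ℤ
    fixes₁⇒≡1 {n} a b n≤i n+j≤l fix =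
      Signed.∣m+n∣n⇒∣m qⁿ∣a-1+b*qⁱ (Signed.∣n⇒∣m*n b (^-monoʳ-∣ q n≤i))
      where
      factor : ∀ a b P J → a * J + b * (P * J) - J ≡ ((a - 1ℤ) + b * P) * J
      factor = solve-∀
      qˡ∣[a-1+b*qⁱ]*qʲ : q ^ l ∣ₛ ((a - 1ℤ) + b * q ^ i) * q ^ j
      qˡ∣[a-1+b*qⁱ]*qʲ = subst (q ^ l ∣ₛ_)
        (trans (cong (λ x → a * q ^ j + b * x - q ^ j) (^-distribˡ-+-* q i j))
               (factor a b (q ^ i) (q ^ j)))
        (Signed.∣ᵤ⇒∣ fix)
      qⁿ∣a-1+b*qⁱ : q ^ n ∣ₛ (a - 1ℤ) + b * q ^ i
      qⁿ∣a-1+b*qⁱ = ^-cancelʳ-∣ q n j n+j≤l qˡ∣[a-1+b*qⁱ]*qʲ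

    fixes₂⇒≡1 : ∀ {n} c d → n Nat.+ i ≤ k → n Nat.+ j ≤ l → q ^ k ∣ c →
                c * q ^ j + d * q ^ (i Nat.+ j) ≡ q ^ (i Nat.+ j) [mod q ^ (l Nat.+ k) ] →
                q ^ n ∣ₛ d - 1ℤ
    fixes₂⇒≡1 {n} c d n+i≤k n+j≤l qᵏ∣c fix =
      ^-cancelʳ-∣ q n (i Nat.+ j) Nat.≤-refl (Signed.∣m+n∣m⇒∣n qᵉ∣row qᵉ∣c*qʲ)
      where
      e = n Nat.+ (i Nat.+ j)
      e≤k+j : e ≤ k Nat.+ j
      e≤k+j = subst (_≤ k Nat.+ j) (Nat.+-assoc n i j) (Nat.+-monoˡ-≤ j n+i≤k)
      e≤l+k : e ≤ l Nat.+ k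
      e≤l+k = subst (_≤ l Nat.+ k) (reorder n i j)
                (Nat.+-mono-≤ n+j≤l (Nat.m+n≤o⇒n≤o n n+i≤k))
        where
        reorder : ∀ n i j → n Nat.+ j Nat.+ i ≡ n Nat.+ (i Nat.+ j)
        reorder = Nat.solve-∀
      regroup : ∀ c d J W → c * J + d * W - W ≡ c * J + (d - 1ℤ) * W
      regroup = solve-∀
      qᵉ∣row : q ^ e ∣ₛ c * q ^ j + (d - 1ℤ) * q ^ (i Nat.+ j)
      qᵉ∣row = Signed.∣-trans (^-monoʳ-∣ q e≤l+k)
        (subst (_ ∣ₛ_) (regroup c d (q ^ j) (q ^ (i Nat.+ j))) (Signed.∣ᵤ⇒∣ fix))
      qᵉ∣c*qʲ : q ^ e ∣ₛ c * q ^ j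
      qᵉ∣c*qʲ = Signed.∣-trans (^-monoʳ-∣ q e≤k+j)
        (subst (_∣ₛ c * q ^ j) (sym (^-distribˡ-+-* q k j))
          (Signed.*-monoˡ-∣ (q ^ j) {q ^ k} {c} (Signed.∣ᵤ⇒∣ qᵏ∣c)))

    stab⇒det≡1 : ∀ {n} g → n ≤ i → n Nat.+ i ≤ k → n Nat.+ j ≤ l →
                 InStab p l k i j g → q ^ n ∣ₛ det g - 1ℤ
    stab⇒det≡1 {n} (mat a b c d) n≤i n+i≤k n+j≤l ((_ , qᵏ∣c) , fix₁ , fix₂) =
      ≡unitriangular⇒det≡1 (mat a b c d)
        (fixes₁⇒≡1 a b n≤i n+j≤l fix₁)
        (Signed.∣-trans (^-monoʳ-∣ q (Nat.m+n≤o⇒m≤o n n+i≤k)) (Signed.∣ᵤ⇒∣ qᵏ∣c))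
        (fixes₂⇒≡1 c d n+i≤k n+j≤l qᵏ∣c fix₂)

    det-stab⇒≡1 : ∀ {n u} → n ≤ i → n Nat.+ i ≤ k → n Nat.+ j ≤ l →
                  InDetStab p l k i j u → InU p n u
    det-stab⇒≡1 {n} {u} n≤i n+i≤k n+j≤l (g , stab , det≡u) =
      Signed.∣⇒∣ᵤ (subst (q ^ n ∣ₛ_) (sym (split (det g) u))
        (Signed.∣m∣n⇒∣m-n (stab⇒det≡1 g n≤i n+i≤k n+j≤l stab)
          (Signed.∣-trans (^-monoʳ-∣ q (Nat.m+n≤o⇒m≤o n n+j≤l)) (Signed.∣ᵤ⇒∣ det≡u))))
      where
      split : ∀ D u → u - 1ℤ ≡ (D - 1ℤ) - (D - u)
      split = solve-∀

  stab-of-det≡ : ∀ {u} g → q ^ k ∣ e21 g → Fixes p l k i j g → det g ≡ u → ¬ q ∣ u →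
                 InDetStab p l k i j u
  stab-of-det≡ g qᵏ∣c fix refl q∤u =
    g , ((q∤u , qᵏ∣c) , fix) , ≡⇒≡-mod {det g} (q ^ l) refl

  fixes-of-exact : ∀ g → e11 g * q ^ j + e12 g * q ^ (i Nat.+ j) ≡ q ^ j →
                   e21 g * q ^ j + e22 g * q ^ (i Nat.+ j) ≡ q ^ (i Nat.+ j) → Fixes p l k i j g
  fixes-of-exact g row₁ row₂ = ≡⇒≡-mod (q ^ l) row₁ , ≡⇒≡-mod (q ^ (l Nat.+ k)) row₂

  Realizable : ℕ → Set
  Realizable e = ∀ t → ¬ q ∣ 1ℤ + t * q ^ e → InDetStab p l k i j (1ℤ + t * q ^ e)

  upper-realizable : Realizable i
  upper-realizable t = stab-of-det≡ g (_ ∣0)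
    (fixes-of-exact g
      (trans (cong (λ x → (1ℤ + t * P) * J + - t * x) (^-distribˡ-+-* q i j)) (row₁ t P J))
      (row₂ J (q ^ (i Nat.+ j))))
    (det-g t P)
    where
    P = q ^ i
    J = q ^ j
    g = mat (1ℤ + t * P) (- t) 0ℤ 1ℤ
    row₁ : ∀ t P J → (1ℤ + t * P) * J + - t * (P * J) ≡ J
    row₁ = solve-∀
    row₂ : ∀ J W → 0ℤ * J + 1ℤ * W ≡ W
    row₂ = solve-∀
    det-g : ∀ t P → (1ℤ + t * P) * 1ℤ - - t * 0ℤ ≡ 1ℤ + t * P
    det-g = solve-∀

  lower-realizable : i ≤ k → Realizable (k ∸ i)
  lower-realizable i≤k t = stab-of-det≡ g
    (Signed.∣⇒∣ᵤ (Signed.∣m⇒∣-m (Signed.∣n⇒∣m*n t Signed.∣-refl)))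
    (fixes-of-exact g
      (row₁ J (q ^ (i Nat.+ j)))
      (trans (cong₂ (λ x y → - (t * x) * J + (1ℤ + t * Q) * y)
                    (^-split q i≤k) (^-distribˡ-+-* q i j))
        (trans (row₂ t P Q J) (sym (^-distribˡ-+-* q i j)))))
    (det-g t Q (t * q ^ k))
    where
    P = q ^ i
    Q = q ^ (k ∸ i)
    J = q ^ j
    g = mat 1ℤ 0ℤ (- (t * q ^ k)) (1ℤ + t * Q)
    row₁ : ∀ J W → 1ℤ * J + 0ℤ * W ≡ J
    row₁ = solve-∀
    row₂ : ∀ t P Q J → - (t * (Q * P)) * J + (1ℤ + t * Q) * (P * J) ≡ P * J
    row₂ = solve-∀
    det-g : ∀ t Q C → 1ℤ * (1ℤ + t * Q) - 0ℤ * - C ≡ 1ℤ + t * Q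
    det-g = solve-∀

  diagonal-realizable : j ≤ l → Realizable (l ∸ j)
  diagonal-realizable j≤l t = stab-of-det≡ g (_ ∣0)
    (≡-mod-of-difference {e11 g * J + e12 g * q ^ (i Nat.+ j)} {J} (q ^ l) t
       (trans (row₁ t R J (q ^ (i Nat.+ j))) (cong (t *_) (sym (^-split q j≤l)))) ,
     ≡⇒≡-mod (q ^ (l Nat.+ k)) (row₂ J (q ^ (i Nat.+ j))))
    (det-g t R)
    where
    R = q ^ (l ∸ j)
    J = q ^ j
    g = mat (1ℤ + t * R) 0ℤ 0ℤ 1ℤ
    row₁ : ∀ t R J W → (1ℤ + t * R) * J + 0ℤ * W - J ≡ t * (R * J)
    row₁ = solve-∀
    row₂ : ∀ J W → 0ℤ * J + 1ℤ * W ≡ W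
    row₂ = solve-∀
    det-g : ∀ t R → (1ℤ + t * R) * 1ℤ - 0ℤ * 0ℤ ≡ 1ℤ + t * R
    det-g = solve-∀

  nIndex-realizable : i ≤ k → j ≤ l → Realizable (nIndex l k i j)
  nIndex-realizable i≤k j≤l with Nat.⊓-sel i ((k ∸ i) ⊓ (l ∸ j)) | Nat.⊓-sel (k ∸ i) (l ∸ j)
  ... | inj₁ n≡i | _          rewrite n≡i = upper-realizable
  ... | inj₂ n≡m | inj₁ m≡k∸i rewrite n≡m | m≡k∸i = lower-realizable i≤k
  ... | inj₂ n≡m | inj₂ m≡l∸j rewrite n≡m | m≡l∸j = diagonal-realizable j≤l

  ≡1⇒det-stab : ∀ e {u} → Realizable e → ¬ q ∣ u → InU p e u → InDetStab p l k i j u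
  ≡1⇒det-stab e {u} realize q∤u u≡1 with Signed.∣ᵤ⇒∣ {q ^ e} {u - 1ℤ} u≡1
  ... | divides t u-1≡t*qᵉ =
    subst (InDetStab p l k i j) (sym u≡1+t*qᵉ) (realize t (subst (λ v → ¬ q ∣ v) u≡1+t*qᵉ q∤u))
    where
    u≡1+t*qᵉ : u ≡ 1ℤ + t * q ^ e
    u≡1+t*qᵉ = trans (shift u) (cong (λ x → 1ℤ + x) u-1≡t*qᵉ)
      where
      shift : ∀ u → u ≡ 1ℤ + (u - 1ℤ)
      shift = solve-∀

proposition4p7 : (p : ℕ) → Prime p → (l k i j : ℕ) → j ≤ l → i ≤ k →
    (u : ℤ) → ¬ ((+ p) ∣ u) →
    InDetStab p l k i j u ⇔ InU p (nIndex l k i j) u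
proposition4p7 p p-prime l k i j j≤l i≤k u p∤u =
  mk⇔ (det-stab⇒≡1 p l k i j n≤i n+i≤k n+j≤l)
      (≡1⇒det-stab p l k i j n (nIndex-realizable p l k i j i≤k j≤l) p∤u)
  where
  instance _ = prime⇒nonZero p-prime
  n = nIndex l k i j
  n≤i : n ≤ i
  n≤i = Nat.m⊓n≤m i _
  n+i≤k : n Nat.+ i ≤ k
  n+i≤k = Nat.m≤o∸n⇒m+n≤o n i≤k (Nat.≤-trans (Nat.m⊓n≤n i _) (Nat.m⊓n≤m (k ∸ i) (l ∸ j)))
  n+j≤l : n Nat.+ j ≤ l
  n+j≤l = Nat.m≤o∸n⇒m+n≤o n j≤l (Nat.≤-trans (Nat.m⊓n≤n i _) (Nat.m⊓n≤n (k ∸ i) (l ∸ j)))
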